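{- Let $X$ be a topological space. If ${\sf GP}(\Omega_X,\Omega_X)$ holds, then ${\sf FG}(\Omega_X,\Omega_X)$ holds.
   Context: An $\omega$-cover of $X$ is an open cover $\mathcal{U}$ with $X\notin\mathcal{U}$ such that each finite subset of $X$ lies in some member of $\mathcal{U}$; $\Omega_X$ is the set of $\omega$-covers. $[S]^{\aleph_0}$ and $[S]^{<\aleph_0}$ denote the countably infinite and the finite subsets of $S$. For a countably infinite $A$ fix a bijective enumeration $A=\{a_n:n\in\mathbb{N}\}$; for $s,T\subseteq A$, $s<T$ means $a_n\in s$, $a_m\in T$ imply $n<m$; a finite $s\subseteq C$ is an initial segment of $C\subseteq A$ if $s<C\setminus s$. The $2^{\mathbb{N}}$ topology on $[A]^{\aleph_0}$ identifies each subset with its characteristic function in $\{0,1\}^{\mathbb{N}}$ (via the enumeration) with the product topology. ${\sf GP}(\Omega_X,\Omega_X)$: for every countably infinite $A\in\Omega_X$ and every $R\subseteq[A]^{\aleph_0}\cap\Omega_X$ open in the $2^{\mathbb{N}}$ topology on $[A]^{\aleph_0}\cap\Omega_X$, for each $S\in[A]^{\aleph_0}\cap\Omega_X$ there is $B\in[S]^{\aleph_0}\cap\Omega_X$ with either $[B]^{\aleph_0}\cap\Omega_X\subseteq R$ or $[B]^{\aleph_0}\cap\Omega_X\cap R=\emptyset$. A family $\mathcal{S}\subseteq[A]^{<\aleph_0}$ is dense if $\mathcal{S}\cap[B]^{<\aleph_0}\neq\emptyset$ for every $B\in[A]^{\aleph_0}\cap\Omega_X$. ${\sf FG}(\Omega_X,\Omega_X)$: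 for every countably infinite $A\in\Omega_X$ and every dense $\mathcal{S}\subseteq[A]^{<\aleph_0}$ there is $B\in[A]^{\aleph_0}\cap\Omega_X$ such that every $C\in[B]^{\aleph_0}\cap\Omega_X$ has an initial segment in $\mathcal{S}$. -}

module Defs where

open import Level using (0ℓ) renaming (suc to lsuc)
open import Data.Nat using (ℕ; _≤_; _<_)
open import Data.Bool using (Bool; true; false)
open import Data.Product using (Σ; ∃; _×_; _,_)
open import Data.Sum using (_⊎_)
open import Data.Unit using (⊤)
open import Data.Empty using (⊥)
open import Data.List using (List)
open import Data.List.Membership.Propositional using (_∈_; _∉_)
open import Data.List.Relation.Unary.All using (All)
open import Data.List.Relation.Unary.Linked using (Linked)
open import Relation.Nullary using (¬_)
open import Relation.Unary using (Pred)
open import Relation.Binary.PropositionalEquality using (_≡_)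

record TopSpace : Set₂ where
  field
    Carrier : Set
    IsOpen  : Pred Carrier 0ℓ → Set₁
    open-ext   : ∀ {U V : Pred Carrier 0ℓ} → (∀ x → (U x → V x) × (V x → U x)) → IsOpen U → IsOpen V
    open-all   : IsOpen (λ _ → ⊤)
    open-none  : IsOpen (λ _ → ⊥)
    open-inter : ∀ {U V} → IsOpen U → IsOpen V → IsOpen (λ x → U x × V x)
    open-union : (I : Set) (U : I → Pred Carrier 0ℓ) → (∀ i → IsOpen (U i)) →
                 IsOpen (λ x → Σ I λ i → U i x)

module _ (T : TopSpace) where
  open TopSpace T

  -- A countably infinite family of subsets of X, bijectively enumerated by ℕ:
  -- a : ℕ → subsets of X, injective up to extensional equality of sets.
  Enum : Set₁
  Enum = ℕ → Pred Carrier 0ℓ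

  InjectiveEnum : Enum → Set
  InjectiveEnum a = ∀ m n → (∀ x → (a m x → a n x) × (a n x → a m x)) → m ≡ n

  -- Subsets of A = {a n : n ∈ ℕ}, identified via the enumeration with points
  -- of 2^ℕ (characteristic functions).
  Sub : Set
  Sub = ℕ → Bool

  _⊆ˢ_ : Sub → Sub → Set
  C ⊆ˢ D = ∀ n → C n ≡ true → D n ≡ true

  Infinite : Sub → Set
  Infinite C = ∀ n → ∃ λ m → n ≤ m × C m ≡ true

  IsOmegaCover : Enum → Sub → Set₁
  IsOmegaCover a C =
      (∀ n → C n ≡ true → IsOpen (a n))
    × (∀ n → C n ≡ true → ¬ (∀ x → a n x))
    × (∀ (F : List Carrier) → ∃ λ n → C n ≡ true × All (a n) F)

  InfOmega : Enum → Sub → Set₁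
  InfOmega a C = Infinite C × IsOmegaCover a C

  full : Sub
  full _ = true

  CountableOmegaCover : Enum → Set₁
  CountableOmegaCover a = InjectiveEnum a × IsOmegaCover a full

  -- R ⊆ [A]^{ℵ0} ∩ Ω_X, open in the subspace topology of 2^ℕ
  IsOpenR : Enum → Pred Sub 0ℓ → Set₁
  IsOpenR a R =
      (∀ C → R C → InfOmega a C)
    × (∀ C → R C → ∃ λ k → ∀ D → InfOmega a D →
          (∀ i → i < k → D i ≡ C i) → R D)

  GP : Set₁
  GP = ∀ (a : Enum) → CountableOmegaCover a →
       ∀ (R : Pred Sub 0ℓ) → IsOpenR a R →
       ∀ (S : Sub) → InfOmega a S →
       Σ Sub λ B → B ⊆ˢ S × InfOmega a B ×
         ((∀ C → C ⊆ˢ B → InfOmega a C → R C)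
          ⊎ (∀ C → C ⊆ˢ B → InfOmega a C → ¬ R C))

  -- Finite subsets of A, coded canonically as strictly increasing lists
  -- of indices.
  FinSub : List ℕ → Set
  FinSub s = Linked _<_ s

  _⊆ᶠ_ : List ℕ → Sub → Set
  s ⊆ᶠ C = All (λ n → C n ≡ true) s

  InitialSegment : List ℕ → Sub → Set
  InitialSegment s C =
    s ⊆ᶠ C × (∀ i m → i ∈ s → C m ≡ true → m ∉ s → i < m)

  Dense : Enum → Pred (List ℕ) 0ℓ → Set₁
  Dense a 𝒮 = ∀ B → InfOmega a B → ∃ λ s → FinSub s × 𝒮 s × s ⊆ᶠ B

  FG : Set₁
  FG = ∀ (a : Enum) → CountableOmegaCover a →
       ∀ (𝒮 : Pred (List ℕ) 0ℓ) → (∀ s → 𝒮 s → FinSub s) → Dense a 𝒮 →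
       Σ Sub λ B → InfOmega a B ×
         (∀ C → C ⊆ˢ B → InfOmega a C →
            ∃ λ s → FinSub s × 𝒮 s × InitialSegment s C)

-- Apply GP to the open set R of those C having an initial segment in 𝒮. If
-- the homogeneous B lies inside R, it witnesses FG. The other alternative is
-- impossible: density gives s ∈ 𝒮 with s ⊆ B, and C = s ∪ {bₙ ∈ B : n > max s}
-- is an ω-cover with initial segment s. It is an ω-cover because dropping
-- finitely many members, none equal to X, keeps an ω-cover: add to the finite
-- set one point outside each dropped member. Choosing those points needs
-- excluded middle, which GP itself provides: on the clopen set {C : P} it
-- decides P.
module Submission where

open import Defs
open import Level using (0ℓ)
open import Axiom.ExcludedMiddle using (ExcludedMiddle)
open import Axiom.DoubleNegationElimination using (em⇒dne)
open import Data.Nat using (ℕ; zero; suc; _≤_; _<_; _⊔_; _≤?_; _<?_; z≤n; s≤s)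
open import Data.Nat.Properties
  using (_≟_; ≤-refl; ≤-trans; <-≤-trans; ≤∧≢⇒<; ≮⇒≥; <⇒≱; m≤m⊔n; m≤n⊔m)
open import Data.Bool using (true; false)
open import Data.Product using (∃; _×_; _,_; proj₁; proj₂)
open import Data.Sum using (inj₁; inj₂)
open import Data.Empty using (⊥-elim)
open import Data.List using (List; []; _∷_; _++_)
open import Data.List.Extrema.Nat using (max; xs≤max)
open import Data.List.Membership.Propositional using (_∈_; _∉_)
open import Data.List.Membership.DecPropositional _≟_ using (_∈?_)
open import Data.List.Relation.Unary.All using (All; []; _∷_)
import Data.List.Relation.Unary.All as All
import Data.List.Relation.Unary.All.Properties as All
open import Relation.Nullary using (¬_; yes; no; contradiction)
open import Relation.Nullary.Decidable using (does; dec-true; dec-false)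
open import Relation.Unary using (Pred)
open import Relation.Binary.PropositionalEquality using (_≡_; _≢_; refl; sym; trans)

¬∀⇒∃¬ : ExcludedMiddle 0ℓ → {A : Set} {P : A → Set} →
        ¬ (∀ x → P x) → ∃ λ x → ¬ P x
¬∀⇒∃¬ em ¬∀ = dne λ ¬∃ → ¬∀ λ x → dne λ ¬Px → ¬∃ (x , ¬Px)
  where dne = em⇒dne em

bound : List ℕ → ℕ
bound s = suc (max 0 s)

∈⇒<bound : ∀ {i s} → i ∈ s → i < bound s
∈⇒<bound {s = s} i∈s = s≤s (All.lookup (xs≤max 0 s) i∈s)

module _ (T : TopSpace) where
  open TopSpace T

  -- InfOmega without the openness clause: that clause lives in Set₁, so it
  -- cannot occur in the Set-valued sets R of GP, and it holds for free for
  -- subfamilies of an ω-cover.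
  InfOmega₀ : Enum T → Sub T → Set
  InfOmega₀ a C = Infinite T C × (∀ n → C n ≡ true → ¬ (∀ x → a n x))
                × (∀ (F : List Carrier) → ∃ λ n → C n ≡ true × All (a n) F)

  infOmega₀⇒infOmega : ∀ {a} → CountableOmegaCover T a →
                       ∀ {C} → InfOmega₀ a C → InfOmega T a C
  infOmega₀⇒infOmega (_ , open-a , _) (inf , nonfull , cover) =
    inf , (λ n _ → open-a n refl) , nonfull , cover

  infOmega⇒infOmega₀ : ∀ {a C} → InfOmega T a C → InfOmega₀ a C
  infOmega⇒infOmega₀ (inf , _ , nonfull , cover) = inf , nonfull , cover

  full-infOmega : ∀ {a} → CountableOmegaCover T a → InfOmega T a (full T)
  full-infOmega (_ , ω) = (λ n → n , ≤-refl , refl) , ω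

  GP⇒excludedMiddle : GP T → ∀ {a} → CountableOmegaCover T a → ExcludedMiddle 0ℓ
  GP⇒excludedMiddle gp {a} ca {P} with gp a ca R R-open (full T) (full-infOmega ca)
    where
    R : Pred (Sub T) 0ℓ
    R C = InfOmega₀ a C × P
    R-open : IsOpenR T a R
    R-open = (λ C r → infOmega₀⇒infOmega ca (proj₁ r))
           , (λ C (_ , p) → 0 , λ D ωD _ → infOmega⇒infOmega₀ ωD , p)
  ... | B , _ , ωB , inj₁ all∈R = yes (proj₂ (all∈R B (λ _ b → b) ωB))
  ... | B , _ , ωB , inj₂ none∈R =
    no λ p → none∈R B (λ _ b → b) ωB (infOmega⇒infOmega₀ ωB , p)

  exclude-member : ExcludedMiddle 0ℓ → {a : Enum T} {B : Sub T} →
                   (∀ n → B n ≡ true → ¬ (∀ x → a n x)) →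
                   ∀ k → ∃ λ (G : List Carrier) →
                     ∀ n → B n ≡ true → All (a n) G → k ≢ n
  exclude-member em {B = B} nonfull k with B k in Bk
  ... | true with ¬∀⇒∃¬ em (nonfull k Bk)
  ...   | x , x∉aₖ = x ∷ [] , λ { _ _ (x∈aₖ ∷ []) refl → x∉aₖ x∈aₖ }
  exclude-member em nonfull k | false =
    [] , λ { _ Bk≡true _ refl → contradiction (trans (sym Bk≡true) Bk) λ () }

  cofinal-cover : ExcludedMiddle 0ℓ → {a : Enum T} {B : Sub T} →
                  (∀ n → B n ≡ true → ¬ (∀ x → a n x)) →
                  (∀ (F : List Carrier) → ∃ λ n → B n ≡ true × All (a n) F) →
                  ∀ k F → ∃ λ n → k ≤ n × B n ≡ true × All (a n) F
  cofinal-cover em nonfull cover zero F with cover F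
  ... | n , Bn , F⊆aₙ = n , z≤n , Bn , F⊆aₙ
  cofinal-cover em nonfull cover (suc k) F with exclude-member em nonfull k
  ... | G , G⊆aₙ⇒k≢n with cofinal-cover em nonfull cover k (G ++ F)
  ...   | n , k≤n , Bn , G++F⊆aₙ with All.++⁻ G G++F⊆aₙ
  ...     | G⊆aₙ , F⊆aₙ = n , ≤∧≢⇒< k≤n (G⊆aₙ⇒k≢n n Bn G⊆aₙ) , Bn , F⊆aₙ

  HasInitialSegmentIn : Pred (List ℕ) 0ℓ → Sub T → Set
  HasInitialSegmentIn 𝒮 C = ∃ λ s → FinSub T s × 𝒮 s × InitialSegment T s C

  initialSegment-agree : ∀ {s C D} → InitialSegment T s C →
                         (∀ i → i < bound s → D i ≡ C i) → InitialSegment T s D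
  initialSegment-agree {s} {D = D} (s⊆C , s<C∖s) D≗C =
      All.tabulate (λ i∈s → trans (D≗C _ (∈⇒<bound i∈s)) (All.lookup s⊆C i∈s))
    , s<D∖s
    where
    s<D∖s : ∀ i m → i ∈ s → D m ≡ true → m ∉ s → i < m
    s<D∖s i m i∈s Dm m∉s with m <? bound s
    ... | yes m<k = s<C∖s i m i∈s (trans (sym (D≗C m m<k)) Dm) m∉s
    ... | no m≮k = <-≤-trans (∈⇒<bound i∈s) (≮⇒≥ m≮k)

  graft : List ℕ → ℕ → Sub T → Sub T
  graft s k B n with k ≤? n
  ... | yes _ = B n
  ... | no _  = does (n ∈? s)

  graft-≥ : ∀ {s k B n} → k ≤ n → graft s k B n ≡ B n
  graft-≥ {k = k} {n = n} k≤n with k ≤? n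
  ... | yes _  = refl
  ... | no k≰n = contradiction k≤n k≰n

  graft-< : ∀ {s k B n} → n < k → graft s k B n ≡ does (n ∈? s)
  graft-< {k = k} {n = n} n<k with k ≤? n
  ... | yes k≤n = contradiction k≤n (<⇒≱ n<k)
  ... | no _    = refl

  graft-⊆ : ∀ {s B} k → _⊆ᶠ_ T s B → _⊆ˢ_ T (graft s k B) B
  graft-⊆ {s} k s⊆B n gn with k ≤? n
  ... | yes _ = gn
  ... | no _ with n ∈? s
  ...   | yes n∈s = All.lookup s⊆B n∈s
  graft-⊆ k s⊆B n () | no _ | no _

  initialSegment-graft : ∀ {s B} → InitialSegment T s (graft s (bound s) B)
  initialSegment-graft {s} {B} = All.tabulate s⊆graft , s<graft∖s
    where
    s⊆graft : ∀ {i} → i ∈ s → graft s (bound s) B i ≡ true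
    s⊆graft {i} i∈s = trans (graft-< (∈⇒<bound i∈s)) (dec-true (i ∈? s) i∈s)
    s<graft∖s : ∀ i m → i ∈ s → graft s (bound s) B m ≡ true → m ∉ s → i < m
    s<graft∖s i m i∈s gm m∉s with m <? bound s
    ... | yes m<k = contradiction (trans (sym gm) graft≡false) λ ()
      where
      graft≡false : graft s (bound s) B m ≡ false
      graft≡false = trans (graft-< m<k) (dec-false (m ∈? s) m∉s)
    ... | no m≮k = <-≤-trans (∈⇒<bound i∈s) (≮⇒≥ m≮k)

  graft-infOmega : ExcludedMiddle 0ℓ → ∀ {a s B} k → _⊆ᶠ_ T s B →
                   InfOmega T a B → InfOmega T a (graft s k B)
  graft-infOmega em {a} {s} {B} k s⊆B (infB , open-B , nonfull-B , cover-B) =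
      inf
    , (λ n gn → open-B n (graft-⊆ k s⊆B n gn))
    , (λ n gn → nonfull-B n (graft-⊆ k s⊆B n gn))
    , cover
    where
    inf : Infinite T (graft s k B)
    inf n with infB (n ⊔ k)
    ... | m , n⊔k≤m , Bm =
      m , ≤-trans (m≤m⊔n n k) n⊔k≤m , trans (graft-≥ (≤-trans (m≤n⊔m n k) n⊔k≤m)) Bm
    cover : ∀ F → ∃ λ n → graft s k B n ≡ true × All (a n) F
    cover F with cofinal-cover em nonfull-B cover-B k F
    ... | n , k≤n , Bn , F⊆aₙ = n , trans (graft-≥ k≤n) Bn , F⊆aₙ

lemma9 : (T : TopSpace) → GP T → FG T
lemma9 T gp a ca 𝒮 _ dense with gp a ca R (R⊆ω , R-open) (full T) (full-infOmega T ca)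
  where
  R : Pred (Sub T) 0ℓ
  R C = InfOmega₀ T a C × HasInitialSegmentIn T 𝒮 C
  R⊆ω : ∀ C → R C → InfOmega T a C
  R⊆ω C (ωC , _) = infOmega₀⇒infOmega T ca ωC
  R-open : ∀ C → R C → ∃ λ k →
           ∀ D → InfOmega T a D → (∀ i → i < k → D i ≡ C i) → R D
  R-open C (_ , s , fs , s∈𝒮 , seg) = bound s , λ D ωD D≗C →
    infOmega⇒infOmega₀ T ωD , s , fs , s∈𝒮 , initialSegment-agree T seg D≗C
... | B , _ , ωB , inj₁ all∈R = B , ωB , λ C C⊆B ωC → proj₂ (all∈R C C⊆B ωC)
... | B , _ , ωB , inj₂ none∈R with dense B ωB
...   | s , fs , s∈𝒮 , s⊆B = ⊥-elim (none∈R C (graft-⊆ T (bound s) s⊆B) ωC C∈R)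
  where
  C : Sub T
  C = graft T s (bound s) B
  ωC : InfOmega T a C
  ωC = graft-infOmega T (GP⇒excludedMiddle T gp ca) (bound s) s⊆B ωB
  C∈R : InfOmega₀ T a C × HasInitialSegmentIn T 𝒮 C
  C∈R = infOmega⇒infOmega₀ T ωC , s , fs , s∈𝒮 , initialSegment-graft T
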